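{- Let $n\ge0$ and $T\in\mathrm{RV}_{n;2}$ with $\mathrm{val}(T)=2^{n+1}+j$. Then $\mathrm{val}(\mathrm{Inv}(T))=2^{n+1}-j$.
   Context: $\tau(i)=|i+1|-1$. Radius-value trees: a height-$0$ tree is a single vertex labeled by an even integer, its value. A height-$(n+1)$ tree is a 4-tuple $T=(l,T_1,T_2,T_3)$ with $l$ even, $T_1,T_2,T_3$ radius-value trees of height $n$, and $|l-\mathrm{val}(T_1)-\mathrm{val}(T_3)|\le\tau(\mathrm{val}(T_2))$; $\mathrm{val}(T)=l$. $\mathrm{RV}_{n;2}$ is the set of height-$n$ radius-value trees all of whose leaves are labeled $2$. The involution $\mathrm{Inv}$ is defined by $\mathrm{Inv}(T)=T$ for height $0$, and for $T=(\mathrm{val}(T_1)+\mathrm{val}(T_3)+j,T_1,T_2,T_3)$ by $\mathrm{Inv}(T)=(\mathrm{val}(\mathrm{Inv}(T_1))+\mathrm{val}(\mathrm{Inv}(T_3))-j,\ \mathrm{Inv}(T_1),\ T_2,\ \mathrm{Inv}(T_3))$. -}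

module Defs where

open import Data.Nat using (ℕ; zero; suc)
open import Data.Integer using (ℤ; +_; _+_; _-_; -_; ∣_∣; _≤_; _*_)
open import Data.Product using (_×_; Σ)
open import Relation.Binary.PropositionalEquality using (_≡_)

Even : ℤ → Set
Even i = Σ ℤ (λ k → i ≡ + 2 * k)

τ : ℤ → ℤ
τ i = + ∣ i + + 1 ∣ - + 1

data Tree : ℕ → Set where
  leaf : ℤ → Tree zero
  node : {n : ℕ} → ℤ → Tree n → Tree n → Tree n → Tree (suc n)

val : {n : ℕ} → Tree n → ℤ
val (leaf l) = l
val (node l _ _ _) = l

IsRV : {n : ℕ} → Tree n → Set
IsRV (leaf l) = Even l
IsRV (node l T₁ T₂ T₃) =
  Even l × IsRV T₁ × IsRV T₂ × IsRV T₃
  × + ∣ l - val T₁ - val T₃ ∣ ≤ τ (val T₂)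

Leaves2 : {n : ℕ} → Tree n → Set
Leaves2 (leaf l) = l ≡ + 2
Leaves2 (node _ T₁ T₂ T₃) = Leaves2 T₁ × Leaves2 T₂ × Leaves2 T₃

RV2 : {n : ℕ} → Tree n → Set
RV2 T = IsRV T × Leaves2 T

-- the involution Inv, with j = l - val T₁ - val T₃
Inv : {n : ℕ} → Tree n → Tree n
Inv (leaf l) = leaf l
Inv (node l T₁ T₂ T₃) =
  node (val (Inv T₁) + val (Inv T₃) - (l - val T₁ - val T₃)) (Inv T₁) T₂ (Inv T₃)

-- Inv replaces the excess j of a node over its outer children T₁, T₃ by −j, and Inv
-- is applied to T₁, T₃ but not to T₂.  Hence val T + val (Inv T) depends only on the
-- leaves reached through outer children: it is twice their sum, which for RV_{n;2}
-- is 2 · 2^{n+1}.  The radius-value constraint plays no role.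
{-# OPTIONS --safe #-}
module Submission where

open import Defs
open import Data.Nat using (ℕ; suc; zero; _^_)
open import Data.Integer using (ℤ; +_; _+_; _-_; _*_)
open import Data.Integer.Properties using (pos-*)
open import Data.Integer.Tactic.RingSolver using (solve-∀)
open import Data.Product using (_,_)
open import Relation.Binary.PropositionalEquality using (_≡_; sym; cong₂; module ≡-Reasoning)

outerLeafSum : {n : ℕ} → Tree n → ℤ
outerLeafSum (leaf l) = l
outerLeafSum (node _ T₁ _ T₃) = outerLeafSum T₁ + outerLeafSum T₃

val-Inv : {n : ℕ} (T : Tree n) → val (Inv T) ≡ + 2 * outerLeafSum T - val T
val-Inv (leaf l) = double-minus l
  where
  double-minus : ∀ x → x ≡ + 2 * x - x
  double-minus = solve-∀
val-Inv (node l T₁ T₂ T₃) = begin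
  val (Inv T₁) + val (Inv T₃) - (l - val T₁ - val T₃)
    ≡⟨ cong₂ (λ a b → a + b - (l - val T₁ - val T₃)) (val-Inv T₁) (val-Inv T₃) ⟩
  (+ 2 * s₁ - val T₁) + (+ 2 * s₃ - val T₃) - (l - val T₁ - val T₃)
    ≡⟨ excesses-cancel s₁ s₃ (val T₁) (val T₃) l ⟩
  + 2 * (s₁ + s₃) - l ∎
  where
  open ≡-Reasoning
  s₁ = outerLeafSum T₁
  s₃ = outerLeafSum T₃
  excesses-cancel : ∀ s₁ s₃ v₁ v₃ l →
    (+ 2 * s₁ - v₁) + (+ 2 * s₃ - v₃) - (l - v₁ - v₃) ≡ + 2 * (s₁ + s₃) - l
  excesses-cancel = solve-∀

outerLeafSum-Leaves2 : (n : ℕ) (T : Tree n) → Leaves2 T → outerLeafSum T ≡ + (2 ^ suc n)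
outerLeafSum-Leaves2 zero (leaf l) l≡2 = l≡2
outerLeafSum-Leaves2 (suc n) (node _ T₁ _ T₃) (h₁ , _ , h₃) = begin
  outerLeafSum T₁ + outerLeafSum T₃
    ≡⟨ cong₂ _+_ (outerLeafSum-Leaves2 n T₁ h₁) (outerLeafSum-Leaves2 n T₃ h₃) ⟩
  + (2 ^ suc n) + + (2 ^ suc n) ≡⟨ sym (two-* (+ (2 ^ suc n))) ⟩
  + 2 * + (2 ^ suc n)           ≡⟨ sym (pos-* 2 (2 ^ suc n)) ⟩
  + (2 ^ suc (suc n))           ∎
  where
  open ≡-Reasoning
  two-* : ∀ x → + 2 * x ≡ x + x
  two-* = solve-∀

lemma4p4 : (n : ℕ) (T : Tree n) → RV2 T → (j : ℤ)
    → val T ≡ + (2 ^ suc n) + j → val (Inv T) ≡ + (2 ^ suc n) - j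
lemma4p4 n T (_ , leaves2) j val≡ = begin
  val (Inv T)                                  ≡⟨ val-Inv T ⟩
  + 2 * outerLeafSum T - val T                 ≡⟨ cong₂ (λ s v → + 2 * s - v) (outerLeafSum-Leaves2 n T leaves2) val≡ ⟩
  + 2 * + (2 ^ suc n) - (+ (2 ^ suc n) + j)    ≡⟨ reflect-about (+ (2 ^ suc n)) j ⟩
  + (2 ^ suc n) - j                            ∎
  where
  open ≡-Reasoning
  reflect-about : ∀ k j → + 2 * k - (k + j) ≡ k - j
  reflect-about = solve-∀
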